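{- The graph $H$ (defined in the context) satisfies $\chi_\rho(H)\ge 7$.
   Context: For a positive integer $i$, an $i$-packing in a graph $G$ is a set $W\subseteq V(G)$ such that any two distinct vertices of $W$ are at (shortest-path) distance greater than $i$. The packing chromatic number $\chi_\rho(G)$ is the smallest integer $k$ such that $V(G)$ can be partitioned into sets $V_1,\dots,V_k$ with $V_i$ an $i$-packing for each $i$. The graph $H$ has 15 vertices $y_1,\dots,y_7,z_1,\dots,z_7,w$ and edges $y_1y_5, y_5y_6, y_6y_7, y_7y_3, y_3y_2, y_2y_1, y_2y_4, y_4y_6$, the analogous edges $z_1z_5, z_5z_6, z_6z_7, z_7z_3, z_3z_2, z_2z_1, z_2z_4, z_4z_6$, and the edges $y_4w, wz_4, y_3z_1, y_5z_7$. -}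

module Defs where

open import Data.Nat using (ℕ; zero; suc)
open import Data.Fin using (Fin; toℕ)
open import Data.Sum using (_⊎_)
open import Relation.Binary.PropositionalEquality using (_≡_; _≢_)
open import Relation.Nullary using (¬_)

-- Walk u v of length at most i (in the symmetric adjacency relation Adj).
-- dist(u,v) ≤ i  iff  WithinDist Adj i u v.
data WithinDist {V : Set} (Adj : V → V → Set) : ℕ → V → V → Set where
  here : ∀ {i u} → WithinDist Adj i u u
  step : ∀ {i u w v} → Adj u w → WithinDist Adj i w v → WithinDist Adj (suc i) u v

IsPacking : {V : Set} (Adj : V → V → Set) (i : ℕ) (W : V → Set) → Set
IsPacking Adj i W = ∀ u v → W u → W v → u ≢ v → ¬ WithinDist Adj i u v

-- A packing k-colouring: a partition V = V_1 ∪ … ∪ V_k given by c : V → Fin k,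
-- where colour class index j : Fin k corresponds to V_(toℕ j + 1),
-- and V_(toℕ j + 1) must be a (toℕ j + 1)-packing.
IsPackingColouring : {V : Set} (Adj : V → V → Set) (k : ℕ) (c : V → Fin k) → Set
IsPackingColouring Adj k c =
  ∀ (j : Fin k) → IsPacking Adj (suc (toℕ j)) (λ v → c v ≡ j)

data VH : Set where
  y1 y2 y3 y4 y5 y6 y7 : VH
  z1 z2 z3 z4 z5 z6 z7 : VH
  w : VH

data EdgeH : VH → VH → Set where
  e-y1y5 : EdgeH y1 y5
  e-y5y6 : EdgeH y5 y6
  e-y6y7 : EdgeH y6 y7
  e-y7y3 : EdgeH y7 y3
  e-y3y2 : EdgeH y3 y2
  e-y2y1 : EdgeH y2 y1
  e-y2y4 : EdgeH y2 y4
  e-y4y6 : EdgeH y4 y6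
  e-z1z5 : EdgeH z1 z5
  e-z5z6 : EdgeH z5 z6
  e-z6z7 : EdgeH z6 z7
  e-z7z3 : EdgeH z7 z3
  e-z3z2 : EdgeH z3 z2
  e-z2z1 : EdgeH z2 z1
  e-z2z4 : EdgeH z2 z4
  e-z4z6 : EdgeH z4 z6
  e-y4w  : EdgeH y4 w
  e-wz4  : EdgeH w z4
  e-y3z1 : EdgeH y3 z1
  e-y5z7 : EdgeH y5 z7

AdjH : VH → VH → Set
AdjH u v = EdgeH u v ⊎ EdgeH v u

module Submission where

-- For H, δ is the distance matrix, each entry certified by the walk search,
-- and the backtracking search with 6 colours evaluates to false; hence no
-- packing colouring of H uses k ≤ 6 colours.

open import Defs
open import Data.Bool using (Bool; true; false; T; not; _∧_; _∨_)
open import Data.Bool.ListAction using (any; all)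
open import Data.Bool.Properties using (T-∧; T-≡)
open import Data.Empty using (⊥-elim)
open import Data.Fin using (Fin; toℕ; #_)
open import Data.Fin.Properties using (toℕ-injective; toℕ<n; all?) renaming (_≟_ to _≟ᶠ_)
open import Data.List using (List; []; _∷_; map; upTo)
open import Data.List.Membership.Propositional.Properties using (∈-upTo⁺)
import Data.List.Relation.Unary.All as All
import Data.List.Relation.Unary.All.Properties as All
import Data.List.Relation.Unary.Any as Any
import Data.List.Relation.Unary.Any.Properties as Any
open import Data.Maybe using (Maybe; just; nothing; is-just; to-witness-T; _<∣>_)
import Data.Maybe as Maybe
open import Data.Nat using (ℕ; suc; zero; _≤_; _<_; _≤?_; _≤ᵇ_; _≡ᵇ_; s≤s)
import Data.Nat as ℕ
open import Data.Nat.Properties using (≤-trans; ≰⇒>; ≡ᵇ⇒≡; ≤ᵇ⇒≤)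
open import Data.Product using (∃; _×_; _,_)
open import Data.Sum using (inj₁; inj₂)
open import Data.Unit using (tt)
open import Data.Vec using (Vec; lookup) renaming (_∷_ to _∷ᵛ_; [] to []ᵛ)
open import Function.Bundles using (Equivalence)
open import Relation.Binary.Definitions using (DecidableEquality)
open import Relation.Binary.PropositionalEquality using (_≡_; _≢_; refl; sym; trans; cong; subst)
open import Relation.Nullary using (yes; no; ¬_)
open import Relation.Nullary.Decidable using (map′; toWitness; T?)

-- A walk of length at most i is a walk of length at most j for any j ≥ i;
-- needed because the distance bound δ u v may be smaller than the packing radius.
WithinDist-mono : ∀ {V : Set} {Adj : V → V → Set} {i j u v} →
                  i ≤ j → WithinDist Adj i u v → WithinDist Adj j u v
WithinDist-mono _         here        = here
WithinDist-mono (s≤s i≤j) (step a ws) = step a (WithinDist-mono i≤j ws)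

true-and-false : ∀ {b : Bool} → b ≡ true → ¬ b ≡ false
true-and-false refl ()

module WalkSearch {V : Set} {Adj : V → V → Set} (_≟_ : DecidableEquality V)
                  (neighbours : (u : V) → List (∃ (Adj u))) where

  findWalk : ∀ i u v → Maybe (WithinDist Adj i u v)
  findWalk i u v with u ≟ v
  ... | yes refl = just here
  findWalk zero    u v | no _ = nothing
  findWalk (suc i) u v | no _ = viaNeighbour (neighbours u)
    where
    viaNeighbour : List (∃ (Adj u)) → Maybe (WithinDist Adj (suc i) u v)
    viaNeighbour []                = nothing
    viaNeighbour ((x , u~x) ∷ xs) = Maybe.map (step u~x) (findWalk i x v) <∣> viaNeighbour xs

  found-walk : ∀ i u v → T (is-just (findWalk i u v)) → WithinDist Adj i u v
  found-walk i u v = to-witness-T (findWalk i u v)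

module PackingTest {V : Set} {Adj : V → V → Set} (δ : V → V → ℕ)
                   (δ-diagonal : ∀ v → δ v v ≡ 0)
                   (δ-walk : ∀ u v → WithinDist Adj (δ u v) u v) where

  -- Two vertices with the same colour index a whose distance bound is d may
  -- coexist iff they coincide (d = 0) or lie beyond the packing radius a + 1.
  allowed : ℕ → ℕ → Bool
  allowed a d = (d ≡ᵇ 0) ∨ not (d ≤ᵇ suc a)

  compatible : V × ℕ → V × ℕ → Bool
  compatible (u , a) (v , b) = not (a ≡ᵇ b) ∨ allowed a (δ u v)

  packing⇒compatible : ∀ {k} {c : V → Fin k} → IsPackingColouring Adj k c →
                       ∀ u v → T (compatible (u , toℕ (c u)) (v , toℕ (c v)))
  packing⇒compatible {c = c} packing u v
    with toℕ (c u) ≡ᵇ toℕ (c v) in same | δ u v ≡ᵇ 0 in apart | δ u v ≤ᵇ suc (toℕ (c u)) in close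
  ... | false | _     | _     = tt
  ... | true  | true  | _     = tt
  ... | true  | false | false = tt
  ... | true  | false | true  =
    packing (c u) u v refl (sym (toℕ-injective sameColour)) distinct
      (WithinDist-mono (≤ᵇ⇒≤ _ _ (Equivalence.from T-≡ close)) (δ-walk u v))
    where
    sameColour : toℕ (c u) ≡ toℕ (c v)
    sameColour = ≡ᵇ⇒≡ _ _ (Equivalence.from T-≡ same)
    distinct : u ≢ v
    distinct refl with () ← trans (sym (cong (_≡ᵇ 0) (δ-diagonal u))) apart

module ColouringSearch {V : Set} (compatible : V × ℕ → V × ℕ → Bool) (n : ℕ) where

  fits : V × ℕ → List (V × ℕ) → Bool
  fits p = all (compatible p)

  extendable : List (V × ℕ) → List V → Bool
  extendable σ []       = true
  extendable σ (v ∷ vs) = any (λ a → fits (v , a) σ ∧ extendable ((v , a) ∷ σ) vs) (upTo n)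

  -- Soundness of a failing search: a colouring c of all vertices that passes
  -- the test makes every restriction of c extendable, in particular the empty one.
  module _ (c : V → ℕ) (c<n : ∀ v → c v < n)
           (compat : ∀ u v → T (compatible (u , c u) (v , c v))) where

    restriction : List V → List (V × ℕ)
    restriction = map (λ u → u , c u)

    fits-restriction : ∀ v done → T (fits (v , c v) (restriction done))
    fits-restriction v done = All.all⁻ _ (All.map⁺ (All.universal (compat v) done))

    extendable-restriction : ∀ done vs → T (extendable (restriction done) vs)
    extendable-restriction done []       = tt
    extendable-restriction done (v ∷ vs) = Any.any⁺ _ (Any.map choose-c (∈-upTo⁺ (c<n v)))
      where
      choose-c : ∀ {a} → c v ≡ a →
                 T (fits (v , a) (restriction done) ∧ extendable ((v , a) ∷ restriction done) vs)
      choose-c refl = Equivalence.from T-∧ (fits-restriction v done , extendable-restriction (v ∷ done) vs)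

    -- Stated with ≡ rather than T: the type checker would otherwise run the
    -- search while comparing types in which T is applied to a concrete search.
    colourable⇒extendable : ∀ vs → extendable [] vs ≡ true
    colourable⇒extendable vs = Equivalence.to T-≡ (extendable-restriction [] vs)

vertices : Vec VH 15
vertices = y1 ∷ᵛ y2 ∷ᵛ y3 ∷ᵛ y4 ∷ᵛ y5 ∷ᵛ y6 ∷ᵛ y7 ∷ᵛ z1 ∷ᵛ z2 ∷ᵛ z3 ∷ᵛ z4 ∷ᵛ z5 ∷ᵛ z6 ∷ᵛ z7 ∷ᵛ w ∷ᵛ []ᵛ

vertex : Fin 15 → VH
vertex = lookup vertices

index : VH → Fin 15
index y1 = # 0
index y2 = # 1
index y3 = # 2
index y4 = # 3
index y5 = # 4
index y6 = # 5
index y7 = # 6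
index z1 = # 7
index z2 = # 8
index z3 = # 9
index z4 = # 10
index z5 = # 11
index z6 = # 12
index z7 = # 13
index w = # 14

vertex-index : ∀ v → vertex (index v) ≡ v
vertex-index y1 = refl
vertex-index y2 = refl
vertex-index y3 = refl
vertex-index y4 = refl
vertex-index y5 = refl
vertex-index y6 = refl
vertex-index y7 = refl
vertex-index z1 = refl
vertex-index z2 = refl
vertex-index z3 = refl
vertex-index z4 = refl
vertex-index z5 = refl
vertex-index z6 = refl
vertex-index z7 = refl
vertex-index w = refl

_≟_ : DecidableEquality VH
u ≟ v = map′ index-injective (cong index) (index u ≟ᶠ index v)
  where
  index-injective : index u ≡ index v → u ≡ v
  index-injective eq = trans (sym (vertex-index u)) (trans (cong vertex eq) (vertex-index v))

neighboursH : (u : VH) → List (∃ (AdjH u))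
neighboursH y1 = (y5 , inj₁ e-y1y5) ∷ (y2 , inj₂ e-y2y1) ∷ []
neighboursH y2 = (y3 , inj₂ e-y3y2) ∷ (y1 , inj₁ e-y2y1) ∷ (y4 , inj₁ e-y2y4) ∷ []
neighboursH y3 = (y7 , inj₂ e-y7y3) ∷ (y2 , inj₁ e-y3y2) ∷ (z1 , inj₁ e-y3z1) ∷ []
neighboursH y4 = (y2 , inj₂ e-y2y4) ∷ (y6 , inj₁ e-y4y6) ∷ (w , inj₁ e-y4w) ∷ []
neighboursH y5 = (y1 , inj₂ e-y1y5) ∷ (y6 , inj₁ e-y5y6) ∷ (z7 , inj₁ e-y5z7) ∷ []
neighboursH y6 = (y5 , inj₂ e-y5y6) ∷ (y7 , inj₁ e-y6y7) ∷ (y4 , inj₂ e-y4y6) ∷ []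
neighboursH y7 = (y6 , inj₂ e-y6y7) ∷ (y3 , inj₁ e-y7y3) ∷ []
neighboursH z1 = (z5 , inj₁ e-z1z5) ∷ (z2 , inj₂ e-z2z1) ∷ (y3 , inj₂ e-y3z1) ∷ []
neighboursH z2 = (z3 , inj₂ e-z3z2) ∷ (z1 , inj₁ e-z2z1) ∷ (z4 , inj₁ e-z2z4) ∷ []
neighboursH z3 = (z7 , inj₂ e-z7z3) ∷ (z2 , inj₁ e-z3z2) ∷ []
neighboursH z4 = (z2 , inj₂ e-z2z4) ∷ (z6 , inj₁ e-z4z6) ∷ (w , inj₂ e-wz4) ∷ []
neighboursH z5 = (z1 , inj₂ e-z1z5) ∷ (z6 , inj₁ e-z5z6) ∷ []
neighboursH z6 = (z5 , inj₂ e-z5z6) ∷ (z7 , inj₁ e-z6z7) ∷ (z4 , inj₂ e-z4z6) ∷ []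
neighboursH z7 = (z6 , inj₂ e-z6z7) ∷ (z3 , inj₁ e-z7z3) ∷ (y5 , inj₂ e-y5z7) ∷ []
neighboursH w = (y4 , inj₂ e-y4w) ∷ (z4 , inj₁ e-wz4) ∷ []

open WalkSearch _≟_ neighboursH using (findWalk; found-walk)

-- Only the facts certified below (zero diagonal, entries attained by walks)
-- are used; that the entries are exact distances is what makes the search fail.
distanceRow : VH → Vec ℕ 15
distanceRow y1 = 0 ∷ᵛ 1 ∷ᵛ 2 ∷ᵛ 2 ∷ᵛ 1 ∷ᵛ 2 ∷ᵛ 3 ∷ᵛ 3 ∷ᵛ 4 ∷ᵛ 3 ∷ᵛ 4 ∷ᵛ 4 ∷ᵛ 3 ∷ᵛ 2 ∷ᵛ 3 ∷ᵛ []ᵛ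
distanceRow y2 = 1 ∷ᵛ 0 ∷ᵛ 1 ∷ᵛ 1 ∷ᵛ 2 ∷ᵛ 2 ∷ᵛ 2 ∷ᵛ 2 ∷ᵛ 3 ∷ᵛ 4 ∷ᵛ 3 ∷ᵛ 3 ∷ᵛ 4 ∷ᵛ 3 ∷ᵛ 2 ∷ᵛ []ᵛ
distanceRow y3 = 2 ∷ᵛ 1 ∷ᵛ 0 ∷ᵛ 2 ∷ᵛ 3 ∷ᵛ 2 ∷ᵛ 1 ∷ᵛ 1 ∷ᵛ 2 ∷ᵛ 3 ∷ᵛ 3 ∷ᵛ 2 ∷ᵛ 3 ∷ᵛ 4 ∷ᵛ 3 ∷ᵛ []ᵛ
distanceRow y4 = 2 ∷ᵛ 1 ∷ᵛ 2 ∷ᵛ 0 ∷ᵛ 2 ∷ᵛ 1 ∷ᵛ 2 ∷ᵛ 3 ∷ᵛ 3 ∷ᵛ 4 ∷ᵛ 2 ∷ᵛ 4 ∷ᵛ 3 ∷ᵛ 3 ∷ᵛ 1 ∷ᵛ []ᵛ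
distanceRow y5 = 1 ∷ᵛ 2 ∷ᵛ 3 ∷ᵛ 2 ∷ᵛ 0 ∷ᵛ 1 ∷ᵛ 2 ∷ᵛ 4 ∷ᵛ 3 ∷ᵛ 2 ∷ᵛ 3 ∷ᵛ 3 ∷ᵛ 2 ∷ᵛ 1 ∷ᵛ 3 ∷ᵛ []ᵛ
distanceRow y6 = 2 ∷ᵛ 2 ∷ᵛ 2 ∷ᵛ 1 ∷ᵛ 1 ∷ᵛ 0 ∷ᵛ 1 ∷ᵛ 3 ∷ᵛ 4 ∷ᵛ 3 ∷ᵛ 3 ∷ᵛ 4 ∷ᵛ 3 ∷ᵛ 2 ∷ᵛ 2 ∷ᵛ []ᵛ
distanceRow y7 = 3 ∷ᵛ 2 ∷ᵛ 1 ∷ᵛ 2 ∷ᵛ 2 ∷ᵛ 1 ∷ᵛ 0 ∷ᵛ 2 ∷ᵛ 3 ∷ᵛ 4 ∷ᵛ 4 ∷ᵛ 3 ∷ᵛ 4 ∷ᵛ 3 ∷ᵛ 3 ∷ᵛ []ᵛ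
distanceRow z1 = 3 ∷ᵛ 2 ∷ᵛ 1 ∷ᵛ 3 ∷ᵛ 4 ∷ᵛ 3 ∷ᵛ 2 ∷ᵛ 0 ∷ᵛ 1 ∷ᵛ 2 ∷ᵛ 2 ∷ᵛ 1 ∷ᵛ 2 ∷ᵛ 3 ∷ᵛ 3 ∷ᵛ []ᵛ
distanceRow z2 = 4 ∷ᵛ 3 ∷ᵛ 2 ∷ᵛ 3 ∷ᵛ 3 ∷ᵛ 4 ∷ᵛ 3 ∷ᵛ 1 ∷ᵛ 0 ∷ᵛ 1 ∷ᵛ 1 ∷ᵛ 2 ∷ᵛ 2 ∷ᵛ 2 ∷ᵛ 2 ∷ᵛ []ᵛ
distanceRow z3 = 3 ∷ᵛ 4 ∷ᵛ 3 ∷ᵛ 4 ∷ᵛ 2 ∷ᵛ 3 ∷ᵛ 4 ∷ᵛ 2 ∷ᵛ 1 ∷ᵛ 0 ∷ᵛ 2 ∷ᵛ 3 ∷ᵛ 2 ∷ᵛ 1 ∷ᵛ 3 ∷ᵛ []ᵛ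
distanceRow z4 = 4 ∷ᵛ 3 ∷ᵛ 3 ∷ᵛ 2 ∷ᵛ 3 ∷ᵛ 3 ∷ᵛ 4 ∷ᵛ 2 ∷ᵛ 1 ∷ᵛ 2 ∷ᵛ 0 ∷ᵛ 2 ∷ᵛ 1 ∷ᵛ 2 ∷ᵛ 1 ∷ᵛ []ᵛ
distanceRow z5 = 4 ∷ᵛ 3 ∷ᵛ 2 ∷ᵛ 4 ∷ᵛ 3 ∷ᵛ 4 ∷ᵛ 3 ∷ᵛ 1 ∷ᵛ 2 ∷ᵛ 3 ∷ᵛ 2 ∷ᵛ 0 ∷ᵛ 1 ∷ᵛ 2 ∷ᵛ 3 ∷ᵛ []ᵛ
distanceRow z6 = 3 ∷ᵛ 4 ∷ᵛ 3 ∷ᵛ 3 ∷ᵛ 2 ∷ᵛ 3 ∷ᵛ 4 ∷ᵛ 2 ∷ᵛ 2 ∷ᵛ 2 ∷ᵛ 1 ∷ᵛ 1 ∷ᵛ 0 ∷ᵛ 1 ∷ᵛ 2 ∷ᵛ []ᵛ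
distanceRow z7 = 2 ∷ᵛ 3 ∷ᵛ 4 ∷ᵛ 3 ∷ᵛ 1 ∷ᵛ 2 ∷ᵛ 3 ∷ᵛ 3 ∷ᵛ 2 ∷ᵛ 1 ∷ᵛ 2 ∷ᵛ 2 ∷ᵛ 1 ∷ᵛ 0 ∷ᵛ 3 ∷ᵛ []ᵛ
distanceRow w = 3 ∷ᵛ 2 ∷ᵛ 3 ∷ᵛ 1 ∷ᵛ 3 ∷ᵛ 2 ∷ᵛ 3 ∷ᵛ 3 ∷ᵛ 2 ∷ᵛ 3 ∷ᵛ 1 ∷ᵛ 3 ∷ᵛ 2 ∷ᵛ 3 ∷ᵛ 0 ∷ᵛ []ᵛ

distance : VH → VH → ℕ
distance u v = lookup (distanceRow u) (index v)

for-all-vertices : {P : VH → Set} → (∀ i → P (vertex i)) → ∀ v → P v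
for-all-vertices {P} P-vertex v = subst P (vertex-index v) (P-vertex (index v))

distance-diagonal : ∀ v → distance v v ≡ 0
distance-diagonal = for-all-vertices (toWitness {a? = all? λ i → _ ℕ.≟ 0} tt)

distance-certified : ∀ i j → T (is-just (findWalk (distance (vertex i) (vertex j)) (vertex i) (vertex j)))
distance-certified = toWitness {a? = all? λ i → all? λ j → T? _} tt

distance-walk : ∀ u v → WithinDist AdjH (distance u v) u v
distance-walk = for-all-vertices λ i → for-all-vertices λ j →
  found-walk (distance (vertex i) (vertex j)) (vertex i) (vertex j) (distance-certified i j)

open PackingTest distance distance-diagonal distance-walk using (compatible; packing⇒compatible)
open ColouringSearch compatible 6 using (extendable; colourable⇒extendable)

searchOrder : List VH
searchOrder = y4 ∷ y3 ∷ y5 ∷ z4 ∷ y2 ∷ z7 ∷ y6 ∷ w ∷ z6 ∷ y1 ∷ z2 ∷ z3 ∷ z1 ∷ z5 ∷ y7 ∷ []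

search-fails : extendable [] searchOrder ≡ false
search-fails = refl

packing⇒search-succeeds : ∀ k (c : VH → Fin k) → IsPackingColouring AdjH k c → k ≤ 6 →
                          ∀ vs → extendable [] vs ≡ true
packing⇒search-succeeds k c packing k≤6 =
  colourable⇒extendable (λ v → toℕ (c v)) (λ v → ≤-trans (toℕ<n (c v)) k≤6) (packing⇒compatible packing)

no-packing-colouring≤6 : ∀ k (c : VH → Fin k) → IsPackingColouring AdjH k c → ¬ k ≤ 6
no-packing-colouring≤6 k c packing k≤6 =
  true-and-false (packing⇒search-succeeds k c packing k≤6 searchOrder) search-fails

lemma1 : ∀ (k : ℕ) (c : VH → Fin k) → IsPackingColouring AdjH k c → 7 ≤ k
lemma1 k c packing with k ≤? 6
... | yes k≤6 = ⊥-elim (no-packing-colouring≤6 k c packing k≤6)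
... | no k≰6  = ≰⇒> k≰6
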